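{- Fix integers $l\ge2$, $k\ge1$ and $m\ge k$. Let $Z_{\mathrm{aux}}(M,N)$ be the weighted number of paths from $(0,0)$ to $(M,N)$ in the auxiliary model, and $\tilde Z(M,N)$ the weighted number of paths from $(0,0)$ to $(M,N)$ in the auxiliary model augmented by the long steps $\mathbb{S}(k)$ (see context). Then for every lattice point $(M,N)$ with $N\ge0$ and $lm-1\le M\le l(m+1)-2$, $$\tilde Z(M,N)=\sum_{j=0}^{\left\lfloor\frac{N-lm+1}{2l}\right\rfloor}Z_{\mathrm{aux}}(M+2jl,N).$$
   Context: Lattice: $\mathcal{L}=\{(x,y)\in\mathbb{Z}^2: x+y\equiv 0 \pmod 2\}$. A lattice path model is given by a set of allowed steps $(x,y)\to(x',y+1)$, each with a positive weight. A path from $(0,0)$ to $(M,N)$ is a sequence $P_0=(0,0),\dots,P_N=(M,N)$ of lattice points with each $P_i\to P_{i+1}$ allowed; its weight is the product of step weights; the weighted number of paths is the sum of weights of all such paths ($0$ if none). Auxiliary model: left wall at $x=0$ (from $(0,y)$ the only step is $(0,y)\to(1,y+1)$, weight $1$); filters of type 1 at $x=d$ for every $d=nl-1$, $n=1,2,\dots$ (from $(d,y)$ the only step is $(d,y)\to(d+1,y+1)$, weight $1$; from $(d+1,y)$ the only steps are $(d+1,y)\to(d+2,y+1)$ with weight $1$ and $(d+1,y)\to(d,y+1)$ with weight $2$); from every other point $(x,y)$ the steps are $(x,y)\to(x\pm1,y+1)$, weight $1$. Long steps $\mathbb{S}(k)$: $(l(k+2)-2,\,lk-2+2m')\to(lk-1,\,lk-1+2m')$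 for all integers $m'\ge0$, each of weight $1$, added to the steps already allowed. $\lfloor\cdot\rfloor$ is the integer part; empty sums are $0$. -}

module Defs where

open import Data.Nat using (ℕ; zero; suc; _+_; _*_; _∸_; _<ᵇ_; _≡ᵇ_; _≤ᵇ_)
open import Data.Nat.DivMod using (_/_)
open import Data.Nat.Divisibility using (_∣?_)
open import Data.Bool using (Bool; true; false; if_then_else_; _∧_; not)
open import Data.List using (List; []; _∷_; map; _++_)
open import Data.Nat.ListAction using (sum)
open import Data.Product using (_×_; _,_)
open import Relation.Nullary.Decidable using (⌊_⌋)

-- A step model on the lattice: from a point (x , y) the list of allowed steps,
-- each given as (x' , w) meaning the step (x , y) → (x' , y + 1) with weight w.
-- All paths starting at (0,0) in the models below stay in x ≥ 0, y ≥ 0, so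
-- ℕ coordinates suffice.
StepModel : Set
StepModel = ℕ → ℕ → List (ℕ × ℕ)

paths : StepModel → ℕ → ℕ → ℕ → ℕ → ℕ
paths S x y zero    M = if x ≡ᵇ M then 1 else 0
paths S x y (suc n) M = sum (map step (S x y))
  where
  step : ℕ × ℕ → ℕ
  step (x' , w) = w * paths S x' (suc y) n M

Z : StepModel → ℕ → ℕ → ℕ
Z S M N = paths S 0 0 N M

-- x = n l - 1 for some n ≥ 1   ⇔  l ∣ x + 1   (x + 1 ≥ 1 automatically)
isFilterD : ℕ → ℕ → Bool
isFilterD l x = ⌊ l ∣? suc x ⌋

-- x = n l for some n ≥ 1   ⇔  l ∣ x and x ≠ 0
isFilterD1 : ℕ → ℕ → Bool
isFilterD1 l x = ⌊ l ∣? x ⌋ ∧ not (x ≡ᵇ 0)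

auxModel : ℕ → StepModel
auxModel l zero    y = (1 , 1) ∷ []
auxModel l (suc x) y =
  if isFilterD l (suc x) then (suc (suc x) , 1) ∷ []
  else if isFilterD1 l (suc x) then (suc (suc x) , 1) ∷ (x , 2) ∷ []
  else (suc (suc x) , 1) ∷ (x , 1) ∷ []

-- long steps S(k): (l(k+2)-2 , lk-2+2m') → (lk-1 , lk-1+2m'),  m' ≥ 0, weight 1
longSteps : ℕ → ℕ → StepModel
longSteps l k x y =
  if (x ≡ᵇ l * (k + 2) ∸ 2) ∧ (l * k ∸ 2 ≤ᵇ y) ∧ ⌊ 2 ∣? (y ∸ (l * k ∸ 2)) ⌋
  then (l * k ∸ 1 , 1) ∷ [] else []

augModel : ℕ → ℕ → StepModel
augModel l k x y = auxModel l x y ++ longSteps l k x y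

Zaux : ℕ → ℕ → ℕ → ℕ
Zaux l = Z (auxModel l)

Ztilde : ℕ → ℕ → ℕ → ℕ → ℕ
Ztilde l k = Z (augModel l k)

sumTo : ℕ → (ℕ → ℕ) → ℕ
sumTo zero    f = f 0
sumTo (suc J) f = sumTo J f + f (suc J)

-- floor division by a positive number (value irrelevant for divisor 0)
floorDiv : ℕ → ℕ → ℕ
floorDiv a zero    = 0
floorDiv a (suc c) = a / suc c

-- Σ_{j=0}^{⌊(a - b)/c⌋} f j  for integers a - b (c > 0); empty (= 0) when a < b,
-- since then ⌊(a-b)/c⌋ ≤ -1.
floorSum : ℕ → ℕ → ℕ → (ℕ → ℕ) → ℕ
floorSum a b c f = if a <ᵇ b then 0 else sumTo (floorDiv (a ∸ b) c) f

-- Away from the source column l(k+2) − 2 of the long steps the augmented model agrees with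
-- the auxiliary one, and the filter at l(k+2) − 1 stops every path that passes to the right of
-- the source from coming back.  To the right of the first filter the auxiliary model is
-- invariant under translation by l, so a path that leaves the source to the right and ends at
-- M + 2l corresponds to one that takes the long step to lk − 1 and ends at M.  Induction on
-- the length gives Z̃(M,N) = Z_aux(M,N) + Z̃(M + 2l,N) for M ≥ lk − 1; iterating, the remainder
-- vanishes as soon as M + 2l(j + 1) > N, which is where the floor stops the sum.
module Submission where

open import Defs
open import Data.Bool using (Bool; true; false; if_then_else_; _∧_)
open import Data.Bool.Properties using (T?)
open import Data.List using (List; []; _∷_; map; _++_)
open import Data.List.Properties using (++-identityʳ)
open import Data.List.Relation.Unary.All as All using (All; []; _∷_)
open import Data.List.Relation.Unary.All.Properties using (++⁺)
open import Data.Nat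
open import Data.Nat.DivMod using (_/_; m≡m%n+[m/n]*n; m%n<n)
open import Data.Nat.Divisibility using (_∣_; _∣?_; ∣-refl; ∣m+n∣m⇒∣n; ∣m∣n⇒∣m+n; n∣m*n; m∣m*n)
open import Data.Nat.ListAction using (sum)
open import Data.Nat.Properties
open import Data.Nat.Tactic.RingSolver using (solve-∀)
open import Data.Product using (_×_; _,_; proj₁; map₁)
open import Data.Sum using (inj₁; inj₂)
open import Function using (_∘_)
open import Function.Bundles using (mk⇔)
open import Relation.Nullary.Decidable using (does; ⌊_⌋; yes; no; isYes≗does; does-⇔; dec-true; dec-false)
open import Relation.Binary.PropositionalEquality
  using (_≡_; _≢_; refl; sym; trans; cong; cong₂; subst; subst₂; module ≡-Reasoning)
open ≡-Reasoning

weightedSum : (ℕ → ℕ) → List (ℕ × ℕ) → ℕ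
weightedSum f []                = 0
weightedSum f ((x , w) ∷ steps) = w * f x + weightedSum f steps

weightedSum-++ : ∀ f steps steps′ →
  weightedSum f (steps ++ steps′) ≡ weightedSum f steps + weightedSum f steps′
weightedSum-++ f []                steps′ = refl
weightedSum-++ f ((x , w) ∷ steps) steps′ =
  trans (cong (w * f x +_) (weightedSum-++ f steps steps′)) (sym (+-assoc (w * f x) _ _))

weightedSum-+ : ∀ f g steps →
  weightedSum (λ x → f x + g x) steps ≡ weightedSum f steps + weightedSum g steps
weightedSum-+ f g []                = refl
weightedSum-+ f g ((x , w) ∷ steps) = begin
  w * (f x + g x) + weightedSum (λ x → f x + g x) steps
    ≡⟨ cong₂ _+_ (*-distribˡ-+ w (f x) (g x)) (weightedSum-+ f g steps) ⟩
  (w * f x + w * g x) + (weightedSum f steps + weightedSum g steps)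
    ≡⟨ +-interchange (w * f x) _ _ _ ⟩
  (w * f x + weightedSum f steps) + (w * g x + weightedSum g steps) ∎
  where
  +-interchange : ∀ a b c d → (a + b) + (c + d) ≡ (a + c) + (b + d)
  +-interchange = solve-∀

weightedSum-cong : ∀ {P : ℕ → Set} {f g} steps → All (P ∘ proj₁) steps →
  (∀ {x} → P x → f x ≡ g x) → weightedSum f steps ≡ weightedSum g steps
weightedSum-cong []                []         f≗g = refl
weightedSum-cong ((x , w) ∷ steps) (px ∷ ps) f≗g =
  cong₂ (λ a b → w * a + b) (f≗g px) (weightedSum-cong steps ps f≗g)

weightedSum-zero : ∀ steps → weightedSum (λ _ → 0) steps ≡ 0
weightedSum-zero []                = refl
weightedSum-zero ((x , w) ∷ steps) = cong₂ _+_ (*-zeroʳ w) (weightedSum-zero steps)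

weightedSum-map₁ : ∀ f g steps → weightedSum f (map (map₁ g) steps) ≡ weightedSum (f ∘ g) steps
weightedSum-map₁ f g []                = refl
weightedSum-map₁ f g ((x , w) ∷ steps) = cong (w * f (g x) +_) (weightedSum-map₁ f g steps)

≡ᵇ-false : ∀ {x M} → x ≢ M → (x ≡ᵇ M) ≡ false
≡ᵇ-false {x} {M} = dec-false (x ≟ M)

StepClosed : StepModel → (ℕ → Set) → Set
StepClosed S R = ∀ {x} y → R x → All (R ∘ proj₁) (S x y)

paths-suc : ∀ S x y n M →
  paths S x y (suc n) M ≡ weightedSum (λ x′ → paths S x′ (suc y) n M) (S x y)
paths-suc S x y n M = sum-map (S x y)
  where
  sum-map : ∀ steps →
    sum (map (λ (x′ , w) → w * paths S x′ (suc y) n M) steps) ≡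
    weightedSum (λ x′ → paths S x′ (suc y) n M) steps
  sum-map []          = refl
  sum-map (_ ∷ steps) = cong (_ +_) (sum-map steps)

module _ (S : StepModel) where

  paths-beyond-reach : (∀ x y → All (λ p → proj₁ p ≤ suc x) (S x y)) →
    ∀ n x y M → x + n < M → paths S x y n M ≡ 0
  paths-beyond-reach rightmost zero x y M x+0<M
    rewrite ≡ᵇ-false (<⇒≢ (subst (_< M) (+-identityʳ x) x+0<M)) = refl
  paths-beyond-reach rightmost (suc n) x y M x+1+n<M = begin
    paths S x y (suc n) M
      ≡⟨ paths-suc S x y n M ⟩
    weightedSum (λ x′ → paths S x′ (suc y) n M) (S x y)
      ≡⟨ weightedSum-cong (S x y) (rightmost x y) unreachable ⟩
    weightedSum (λ _ → 0) (S x y)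
      ≡⟨ weightedSum-zero (S x y) ⟩
    0 ∎
    where
    unreachable : ∀ {x′} → x′ ≤ suc x → paths S x′ (suc y) n M ≡ 0
    unreachable x′≤1+x = paths-beyond-reach rightmost n _ (suc y) M
      (≤-<-trans (+-monoˡ-≤ n x′≤1+x) (subst (_< M) (+-suc x n) x+1+n<M))

  paths-cong : ∀ {R} S′ → StepClosed S R → (∀ {x} y → R x → S x y ≡ S′ x y) →
    ∀ n {x} y M → R x → paths S x y n M ≡ paths S′ x y n M
  paths-cong S′ closed S≗S′ zero    y M Rx = refl
  paths-cong S′ closed S≗S′ (suc n) {x} y M Rx = begin
    paths S x y (suc n) M
      ≡⟨ paths-suc S x y n M ⟩
    weightedSum (λ x′ → paths S x′ (suc y) n M) (S x y)
      ≡⟨ weightedSum-cong (S x y) (closed y Rx) (paths-cong S′ closed S≗S′ n (suc y) M) ⟩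
    weightedSum (λ x′ → paths S′ x′ (suc y) n M) (S x y)
      ≡⟨ cong (weightedSum _) (S≗S′ y Rx) ⟩
    weightedSum (λ x′ → paths S′ x′ (suc y) n M) (S′ x y)
      ≡⟨ paths-suc S′ x y n M ⟨
    paths S′ x y (suc n) M ∎

  paths-translate : ∀ {R} d → StepClosed S R →
    (∀ {x} y → R x → S (x + d) y ≡ map (map₁ (_+ d)) (S x y)) →
    ∀ n {x} y M → R x → paths S (x + d) y n (M + d) ≡ paths S x y n M
  paths-translate d closed periodic zero {x} y M Rx =
    cong (λ b → if b then 1 else 0) (does-⇔ (mk⇔ (+-cancelʳ-≡ d x M) (cong (_+ d))) (x + d ≟ M + d) (x ≟ M))
  paths-translate d closed periodic (suc n) {x} y M Rx = begin
    paths S (x + d) y (suc n) (M + d)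
      ≡⟨ paths-suc S (x + d) y n (M + d) ⟩
    weightedSum (λ x′ → paths S x′ (suc y) n (M + d)) (S (x + d) y)
      ≡⟨ cong (weightedSum _) (periodic y Rx) ⟩
    weightedSum (λ x′ → paths S x′ (suc y) n (M + d)) (map (map₁ (_+ d)) (S x y))
      ≡⟨ weightedSum-map₁ _ (_+ d) (S x y) ⟩
    weightedSum (λ x′ → paths S (x′ + d) (suc y) n (M + d)) (S x y)
      ≡⟨ weightedSum-cong (S x y) (closed y Rx) (paths-translate d closed periodic n (suc y) M) ⟩
    weightedSum (λ x′ → paths S x′ (suc y) n M) (S x y)
      ≡⟨ paths-suc S x y n M ⟨
    paths S x y (suc n) M ∎

∣?-periodic : ∀ {l d} n → l ∣ d → ⌊ l ∣? n + d ⌋ ≡ ⌊ l ∣? n ⌋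
∣?-periodic {l} {d} n l∣d = begin
  ⌊ l ∣? n + d ⌋   ≡⟨ isYes≗does (l ∣? n + d) ⟩
  does (l ∣? n + d) ≡⟨ does-⇔ (mk⇔ dropping adding) (l ∣? n + d) (l ∣? n) ⟩
  does (l ∣? n)     ≡⟨ isYes≗does (l ∣? n) ⟨
  ⌊ l ∣? n ⌋        ∎
  where
  dropping : l ∣ n + d → l ∣ n
  dropping l∣n+d = ∣m+n∣m⇒∣n (subst (l ∣_) (+-comm n d) l∣n+d) l∣d
  adding : l ∣ n → l ∣ n + d
  adding l∣n = ∣m∣n⇒∣m+n l∣n l∣d

backSteps : Bool → Bool → ℕ → List (ℕ × ℕ)
backSteps true  _     x = []
backSteps false true  x = (x , 2) ∷ []
backSteps false false x = (x , 1) ∷ []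

auxBack : ℕ → ℕ → List (ℕ × ℕ)
auxBack l zero    = []
auxBack l (suc x) = backSteps (isFilterD l (suc x)) (isFilterD1 l (suc x)) x

auxModel-≡ : ∀ l x y → auxModel l x y ≡ (suc x , 1) ∷ auxBack l x
auxModel-≡ l zero    y = refl
auxModel-≡ l (suc x) y with isFilterD l (suc x) | isFilterD1 l (suc x)
... | true  | _     = refl
... | false | true  = refl
... | false | false = refl

weightedSum-auxModel : ∀ l f x y →
  weightedSum f (auxModel l x y) ≡ f (suc x) + weightedSum f (auxBack l x)
weightedSum-auxModel l f x y rewrite auxModel-≡ l x y =
  cong (_+ weightedSum f (auxBack l x)) (+-identityʳ (f (suc x)))

backSteps-pred : ∀ b b′ x → All (λ p → proj₁ p ≡ x) (backSteps b b′ x)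
backSteps-pred true  _     x = []
backSteps-pred false true  x = refl ∷ []
backSteps-pred false false x = refl ∷ []

auxBack-pred : ∀ l x → All (λ p → suc (proj₁ p) ≡ x) (auxBack l x)
auxBack-pred l zero    = []
auxBack-pred l (suc x) = All.map (cong suc) (backSteps-pred _ _ x)

auxBack-filter : ∀ l x → l ∣ suc x → auxBack l x ≡ []
auxBack-filter l zero    _ = refl
auxBack-filter l (suc x) l∣2+x
  rewrite isYes≗does (l ∣? suc (suc x)) | dec-true (l ∣? suc (suc x)) l∣2+x = refl

auxModel-closedAbove : ∀ l {b} → l ∣ suc b → StepClosed (auxModel l) (b ≤_)
auxModel-closedAbove l {b} l∣1+b {x} y b≤x rewrite auxModel-≡ l x y =
  m≤n⇒m≤1+n b≤x ∷ backClosed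
  where
  backClosed : All (λ p → b ≤ proj₁ p) (auxBack l x)
  backClosed with m≤n⇒m<n∨m≡n b≤x
  ... | inj₁ b<x  = All.map (λ 1+x′≡x → ≤-pred (subst (b <_) (sym 1+x′≡x) b<x)) (auxBack-pred l x)
  ... | inj₂ refl = subst (All _) (sym (auxBack-filter l b l∣1+b)) []

backSteps-map₁ : ∀ d b b′ x → map (map₁ (_+ d)) (backSteps b b′ x) ≡ backSteps b b′ (x + d)
backSteps-map₁ d true  _     x = refl
backSteps-map₁ d false true  x = refl
backSteps-map₁ d false false x = refl

auxModel-periodic : ∀ l {d} → l ∣ d → ∀ {x} y → 0 < x →
  auxModel l (x + d) y ≡ map (map₁ (_+ d)) (auxModel l x y)
auxModel-periodic l {d} l∣d {suc x} y _ = begin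
  auxModel l (suc x + d) y
    ≡⟨ auxModel-≡ l (suc x + d) y ⟩
  (suc (suc x) + d , 1) ∷ backSteps (isFilterD l (suc x + d)) (isFilterD1 l (suc x + d)) (x + d)
    ≡⟨ cong (λ (b , b′) → _ ∷ backSteps b b′ (x + d)) filters-periodic ⟩
  (suc (suc x) + d , 1) ∷ backSteps (isFilterD l (suc x)) (isFilterD1 l (suc x)) (x + d)
    ≡⟨ cong (_ ∷_) (backSteps-map₁ d _ _ x) ⟨
  map (map₁ (_+ d)) ((suc (suc x) , 1) ∷ auxBack l (suc x))
    ≡⟨ cong (map (map₁ (_+ d))) (auxModel-≡ l (suc x) y) ⟨
  map (map₁ (_+ d)) (auxModel l (suc x) y) ∎
  where
  filters-periodic : (isFilterD l (suc x + d) , isFilterD1 l (suc x + d)) ≡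
                     (isFilterD l (suc x) , isFilterD1 l (suc x))
  filters-periodic = cong₂ _,_ (∣?-periodic (suc (suc x)) l∣d)
                               (cong (_∧ true) (∣?-periodic (suc x) l∣d))

-- Every point reachable from the origin lies in the cone of its column; at the source this
-- guarantees that the long step is available.
data InCone (x : ℕ) : ℕ → Set where
  inCone : ∀ t → InCone x (x + 2 * t)

InCone-suc : ∀ {x y} → InCone x y → InCone (suc x) (suc y)
InCone-suc (inCone t) = inCone t

InCone-pred : ∀ {x y} → InCone (suc x) y → InCone x (suc y)
InCone-pred {x} (inCone t) = subst (InCone x) (shift x t) (inCone (suc t))
  where
  shift : ∀ x t → x + 2 * suc t ≡ suc (suc x + 2 * t)
  shift = solve-∀

InCone-shiftˡ : ∀ {x y} d → InCone (x + 2 * d) y → InCone x y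
InCone-shiftˡ {x} d (inCone t) = subst (InCone x) (shift x d t) (inCone (d + t))
  where
  shift : ∀ x d t → x + 2 * (d + t) ≡ x + 2 * d + 2 * t
  shift = solve-∀

if-∧-false : ∀ {A : Set} {b} c (xs : List A) → b ≡ false → (if b ∧ c then xs else []) ≡ []
if-∧-false c xs refl = refl

if-true : ∀ {A : Set} {b} (xs ys : List A) → b ≡ true → (if b then xs else ys) ≡ xs
if-true xs ys refl = refl

All-if : ∀ {A : Set} {P : A → Set} b {p} → P p → All P (if b then p ∷ [] else [])
All-if true  Pp = Pp ∷ []
All-if false Pp = []

sumTo-cong : ∀ J {f g} → (∀ j → f j ≡ g j) → sumTo J f ≡ sumTo J g
sumTo-cong zero    f≗g = f≗g 0
sumTo-cong (suc J) f≗g = cong₂ _+_ (sumTo-cong J f≗g) (f≗g (suc J))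

telescope : ∀ (f g : ℕ → ℕ) c {M₀} → (∀ {M} → M₀ ≤ M → g M ≡ f M + g (M + c)) →
  ∀ J {M} → M₀ ≤ M → g M ≡ sumTo J (λ j → f (M + j * c)) + g (M + suc J * c)
telescope f g c step zero {M} M₀≤M =
  trans (step M₀≤M) (cong₂ (λ a b → f a + g (M + b)) (sym (+-identityʳ M)) (sym (*-identityˡ c)))
telescope f g c step (suc J) {M} M₀≤M = begin
  g M
    ≡⟨ telescope f g c step J M₀≤M ⟩
  sumTo J f′ + g (M + suc J * c)
    ≡⟨ cong (sumTo J f′ +_) (step (≤-trans M₀≤M (m≤m+n M _))) ⟩
  sumTo J f′ + (f′ (suc J) + g (M + suc J * c + c))
    ≡⟨ +-assoc (sumTo J f′) _ _ ⟨
  sumTo (suc J) f′ + g (M + suc J * c + c)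
    ≡⟨ cong (λ n → sumTo (suc J) f′ + g n) (next-multiple M J c) ⟩
  sumTo (suc J) f′ + g (M + suc (suc J) * c) ∎
  where
  f′ : ℕ → ℕ
  f′ j = f (M + j * c)
  next-multiple : ∀ M J c → M + suc J * c + c ≡ M + suc (suc J) * c
  next-multiple = solve-∀

floorSum-< : ∀ {a b} c f → a < b → floorSum a b c f ≡ 0
floorSum-< {a} {b} c f a<b =
  cong (λ t → if t then 0 else sumTo (floorDiv (a ∸ b) c) f) (dec-true (T? (a <ᵇ b)) (<⇒<ᵇ a<b))

floorSum-≥ : ∀ {a b} c f → b ≤ a → floorSum a b c f ≡ sumTo (floorDiv (a ∸ b) c) f
floorSum-≥ {a} {b} c f b≤a =
  cong (λ t → if t then 0 else sumTo (floorDiv (a ∸ b) c) f) (dec-false (T? (a <ᵇ b)) (≤⇒≯ b≤a ∘ <ᵇ⇒< a b))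

floorDiv-< : ∀ a c → 0 < c → a < suc (floorDiv a c) * c
floorDiv-< a (suc c) _ =
  subst (_< suc (a / suc c) * suc c) (sym (m≡m%n+[m/n]*n a (suc c))) (+-monoˡ-< _ (m%n<n a (suc c)))

below-first-term : ∀ {N M b} → N + 1 < b → b ∸ 1 ≤ M → N < M
below-first-term {N} {M} {b} N+1<b b∸1≤M =
  ≤-trans (subst (suc N ≤_) (pred[m∸n]≡m∸[1+n] b 0) (<⇒≤pred (subst (_< b) (+-comm N 1) N+1<b))) b∸1≤M

beyond-last-term : ∀ {N M b} c → 0 < c → b ≤ N + 1 → b ∸ 1 ≤ M →
  N < M + suc (floorDiv (N + 1 ∸ b) c) * c
beyond-last-term {N} {M} {b} c 0<c b≤N+1 b∸1≤M =
  ≤-pred (subst₂ _≤_ 2+N 2+M+[q+1]c (+-mono-≤ (floorDiv-< (N + 1 ∸ b) c 0<c) b≤1+M))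
  where
  q : ℕ
  q = floorDiv (N + 1 ∸ b) c
  2+N : suc (N + 1 ∸ b + b) ≡ suc (suc N)
  2+N = cong suc (trans (m∸n+n≡m b≤N+1) (+-comm N 1))
  2+M+[q+1]c : suc q * c + suc M ≡ suc (M + suc q * c)
  2+M+[q+1]c = trans (+-suc (suc q * c) M) (cong suc (+-comm (suc q * c) M))
  b≤1+M : b ≤ suc M
  b≤1+M = ≤-trans (m≤n+m∸n b 1) (s≤s b∸1≤M)

module LongSteps (l′ k′ : ℕ) where

  l k : ℕ
  l = 2 + l′
  k = suc k′

  source target base : ℕ
  source = l * (k + 2) ∸ 2
  target = l * k ∸ 1
  base   = l′ + l * k′

  lk≡2+base : l * k ≡ 2 + base
  lk≡2+base = expand l′ k′
    where
    expand : ∀ a b → (2 + a) * suc b ≡ 2 + (a + (2 + a) * b)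
    expand = solve-∀

  l[k+2]≡2+base+2l : l * (k + 2) ≡ 2 + (base + 2 * l)
  l[k+2]≡2+base+2l = expand l′ k′
    where
    expand : ∀ a b → (2 + a) * (suc b + 2) ≡ 2 + (a + (2 + a) * b + 2 * (2 + a))
    expand = solve-∀

  target≡1+base : target ≡ suc base
  target≡1+base = cong (_∸ 1) lk≡2+base

  source≡base+2l : source ≡ base + 2 * l
  source≡base+2l = cong (_∸ 2) l[k+2]≡2+base+2l

  1+source≡target+2l : suc source ≡ target + 2 * l
  1+source≡target+2l = trans (cong suc source≡base+2l) (cong (_+ 2 * l) (sym target≡1+base))

  target≤source : target ≤ source
  target≤source = ≤-pred (subst (suc target ≤_) (sym 1+source≡target+2l) 1+target≤target+2l)
    where
    1+target≤target+2l : suc target ≤ target + 2 * l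
    1+target≤target+2l = subst (_≤ target + 2 * l) (+-comm target 1) (+-monoʳ-≤ target (s≤s z≤n))

  l∸1≤target : suc l′ ≤ target
  l∸1≤target = subst (suc l′ ≤_) (sym target≡1+base) (s≤s (m≤m+n l′ (l * k′)))

  filter-after-source : l ∣ suc (suc source)
  filter-after-source =
    subst (l ∣_) (trans l[k+2]≡2+base+2l (cong (2 +_) (sym source≡base+2l))) (m∣m*n (k + 2))

  longSteps-elsewhere : ∀ {x} y → x ≢ source → longSteps l k x y ≡ []
  longSteps-elsewhere y x≢source = if-∧-false _ _ (≡ᵇ-false x≢source)

  longSteps-source : ∀ {y} → InCone source y → longSteps l k source y ≡ (target , 1) ∷ []
  longSteps-source (inCone t) = if-true _ _
    (cong₂ _∧_ (dec-true (source ≟ source) refl) (cong₂ _∧_ base≤ᵇy 2∣?y∸base))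
    where
    y : ℕ
    y = source + 2 * t
    y≡base+2[l+t] : y ≡ base + 2 * (l + t)
    y≡base+2[l+t] = trans (cong (_+ 2 * t) source≡base+2l) (regroup base l t)
      where
      regroup : ∀ b l t → b + 2 * l + 2 * t ≡ b + 2 * (l + t)
      regroup = solve-∀
    lk∸2≡base : l * k ∸ 2 ≡ base
    lk∸2≡base = cong (_∸ 2) lk≡2+base
    base≤ᵇy : (l * k ∸ 2 ≤ᵇ y) ≡ true
    base≤ᵇy = dec-true (T? _) (≤⇒≤ᵇ (subst₂ _≤_ (sym lk∸2≡base) (sym y≡base+2[l+t]) (m≤m+n base _)))
    2∣?y∸base : ⌊ 2 ∣? (y ∸ (l * k ∸ 2)) ⌋ ≡ true
    2∣?y∸base = trans (isYes≗does (2 ∣? _)) (dec-true (2 ∣? _)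
      (subst (2 ∣_) (sym (trans (cong₂ _∸_ y≡base+2[l+t] lk∸2≡base) (m+n∸m≡n base _))) (m∣m*n (l + t))))

  augModel-elsewhere : ∀ {x} y → x ≢ source → augModel l k x y ≡ auxModel l x y
  augModel-elsewhere {x} y x≢source =
    trans (cong (auxModel l x y ++_) (longSteps-elsewhere y x≢source)) (++-identityʳ _)

  weightedSum-augModel-source : ∀ f {y} → InCone source y →
    weightedSum f (augModel l k source y) ≡ f (suc source) + weightedSum f (auxBack l source) + f target
  weightedSum-augModel-source f {y} cone = begin
    weightedSum f (auxModel l source y ++ longSteps l k source y)
      ≡⟨ weightedSum-++ f (auxModel l source y) _ ⟩
    weightedSum f (auxModel l source y) + weightedSum f (longSteps l k source y)
      ≡⟨ cong₂ _+_ (weightedSum-auxModel l f source y) (cong (weightedSum f) (longSteps-source cone)) ⟩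
    f (suc source) + weightedSum f (auxBack l source) + (f target + 0 + 0)
      ≡⟨ cong (f (suc source) + weightedSum f (auxBack l source) +_) (trans (+-identityʳ _) (+-identityʳ _)) ⟩
    f (suc source) + weightedSum f (auxBack l source) + f target ∎

  augModel-rightmost : ∀ x y → All (λ p → proj₁ p ≤ suc x) (augModel l k x y)
  augModel-rightmost x y = ++⁺ auxSteps longStep
    where
    auxSteps : All (λ p → proj₁ p ≤ suc x) (auxModel l x y)
    auxSteps rewrite auxModel-≡ l x y =
      ≤-refl ∷ All.map (λ 1+x′≡x → m≤n⇒m≤1+n (≤-trans (n≤1+n _) (≤-reflexive 1+x′≡x))) (auxBack-pred l x)
    longStep : All (λ p → proj₁ p ≤ suc x) (longSteps l k x y)
    longStep with x ≟ source
    ... | yes refl = All-if _ (m≤n⇒m≤1+n target≤source)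
    ... | no x≢source rewrite longSteps-elsewhere y x≢source = []

  auxPaths augPaths : ℕ → ℕ → ℕ → ℕ → ℕ
  auxPaths = paths (auxModel l)
  augPaths = paths (augModel l k)

  augPaths-right-of-source : ∀ n {x} y M → source < x → augPaths x y n M ≡ auxPaths x y n M
  augPaths-right-of-source n y M source<x = sym
    (paths-cong (auxModel l) (augModel l k) (auxModel-closedAbove l filter-after-source)
      (λ y source<x → sym (augModel-elsewhere y (>⇒≢ source<x))) n y M source<x)

  auxPaths-periodic : ∀ n {x} y M → suc l′ ≤ x → auxPaths (x + 2 * l) y n (M + 2 * l) ≡ auxPaths x y n M
  auxPaths-periodic = paths-translate (auxModel l) (2 * l) (auxModel-closedAbove l ∣-refl)
    (λ y l∸1≤x → auxModel-periodic l (n∣m*n 2) y (≤-trans (s≤s z≤n) l∸1≤x))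

  augPaths-after-source : ∀ n y M → augPaths (suc source) y n (M + 2 * l) ≡ auxPaths target y n M
  augPaths-after-source n y M = begin
    augPaths (suc source) y n (M + 2 * l)   ≡⟨ augPaths-right-of-source n y _ ≤-refl ⟩
    auxPaths (suc source) y n (M + 2 * l)   ≡⟨ cong (λ x → auxPaths x y n (M + 2 * l)) 1+source≡target+2l ⟩
    auxPaths (target + 2 * l) y n (M + 2 * l) ≡⟨ auxPaths-periodic n y M l∸1≤target ⟩
    auxPaths target y n M                     ∎

  Below : ℕ → ℕ → Set
  Below x y = x ≤ source × InCone x y

  auxBack-below : ∀ {x y} → Below x y → All (λ p → Below (proj₁ p) (suc y)) (auxBack l x)
  auxBack-below {x} {y} (x≤source , cone) = All.map below (auxBack-pred l x)
    where
    below : ∀ {x′} → suc x′ ≡ x → Below x′ (suc y)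
    below 1+x′≡x = ≤-trans (n≤1+n _) (subst (_≤ source) (sym 1+x′≡x) x≤source)
                 , InCone-pred (subst (λ z → InCone z y) (sym 1+x′≡x) cone)

  auxModel-below : ∀ {x y} → x < source → InCone x y → All (λ p → Below (proj₁ p) (suc y)) (auxModel l x y)
  auxModel-below {x} {y} x<source cone rewrite auxModel-≡ l x y =
    (x<source , InCone-suc cone) ∷ auxBack-below {x} {y} (<⇒≤ x<source , cone)

  Splits : ℕ → ℕ → Set
  Splits n M = ∀ {x y} → Below x y → augPaths x y n M ≡ auxPaths x y n M + augPaths x y n (M + 2 * l)

  splits-zero : ∀ {M} → target ≤ M → Splits 0 M
  splits-zero {M} target≤M {x} (x≤source , _) =
    sym (trans (cong (λ b → (if x ≡ᵇ M then 1 else 0) + (if b then 1 else 0)) (≡ᵇ-false x≢M+2l))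
               (+-identityʳ _))
    where
    x≢M+2l : x ≢ M + 2 * l
    x≢M+2l = <⇒≢ (≤-trans (s≤s x≤source)
      (subst (_≤ M + 2 * l) (sym 1+source≡target+2l) (+-monoˡ-≤ (2 * l) target≤M)))

  splits-off-source : ∀ {n M} → Splits n M → ∀ {x y} → x < source → InCone x y →
    augPaths x y (suc n) M ≡ auxPaths x y (suc n) M + augPaths x y (suc n) (M + 2 * l)
  splits-off-source {n} {M} ih {x} {y} x<source cone = begin
    augPaths x y (suc n) M
      ≡⟨ paths-suc (augModel l k) x y n M ⟩
    weightedSum fA (augModel l k x y)
      ≡⟨ cong (weightedSum fA) aug≡aux ⟩
    weightedSum fA (auxModel l x y)
      ≡⟨ weightedSum-cong (auxModel l x y) (auxModel-below x<source cone) ih ⟩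
    weightedSum (λ x′ → fU x′ + fA′ x′) (auxModel l x y)
      ≡⟨ weightedSum-+ fU fA′ (auxModel l x y) ⟩
    weightedSum fU (auxModel l x y) + weightedSum fA′ (auxModel l x y)
      ≡⟨ cong₂ _+_ (paths-suc (auxModel l) x y n M)
                   (trans (paths-suc (augModel l k) x y n (M + 2 * l)) (cong (weightedSum fA′) aug≡aux)) ⟨
    auxPaths x y (suc n) M + augPaths x y (suc n) (M + 2 * l) ∎
    where
    fA fU fA′ : ℕ → ℕ
    fA  x′ = augPaths x′ (suc y) n M
    fU  x′ = auxPaths x′ (suc y) n M
    fA′ x′ = augPaths x′ (suc y) n (M + 2 * l)
    aug≡aux : augModel l k x y ≡ auxModel l x y
    aug≡aux = augModel-elsewhere y (<⇒≢ x<source)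

  splits-at-source : ∀ {n M} → Splits n M → target ≤ M → ∀ {y} → InCone source y →
    augPaths source y (suc n) M ≡ auxPaths source y (suc n) M + augPaths source y (suc n) (M + 2 * l)
  splits-at-source {n} {M} ih target≤M {y} cone = begin
    augPaths source y (suc n) M
      ≡⟨ trans (paths-suc (augModel l k) source y n M) (weightedSum-augModel-source fA cone) ⟩
    fA (suc source) + weightedSum fA back + fA target
      ≡⟨ cong₂ _+_ (cong₂ _+_ (augPaths-right-of-source n (suc y) M ≤-refl) back-splits)
                   (ih (target≤source , target-in-cone)) ⟩
    fU (suc source) + (weightedSum fU back + weightedSum fA′ back) + (fU target + fA′ target)
      ≡⟨ regroup (fU (suc source)) _ _ (fU target) _ ⟩
    (fU (suc source) + weightedSum fU back) + (fU target + weightedSum fA′ back + fA′ target)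
      ≡⟨ cong (λ v → (fU (suc source) + weightedSum fU back) + (v + weightedSum fA′ back + fA′ target))
              (augPaths-after-source n (suc y) M) ⟨
    (fU (suc source) + weightedSum fU back) + (fA′ (suc source) + weightedSum fA′ back + fA′ target)
      ≡⟨ cong₂ _+_ (trans (paths-suc (auxModel l) source y n M) (weightedSum-auxModel l fU source y))
                   (trans (paths-suc (augModel l k) source y n (M + 2 * l)) (weightedSum-augModel-source fA′ cone)) ⟨
    auxPaths source y (suc n) M + augPaths source y (suc n) (M + 2 * l) ∎
    where
    fA fU fA′ : ℕ → ℕ
    fA  x′ = augPaths x′ (suc y) n M
    fU  x′ = auxPaths x′ (suc y) n M
    fA′ x′ = augPaths x′ (suc y) n (M + 2 * l)
    back : List (ℕ × ℕ)
    back = auxBack l source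
    back-splits : weightedSum fA back ≡ weightedSum fU back + weightedSum fA′ back
    back-splits = trans (weightedSum-cong back (auxBack-below (≤-refl , cone)) ih) (weightedSum-+ fU fA′ back)
    target-in-cone : InCone target (suc y)
    target-in-cone =
      InCone-shiftˡ {target} l (subst (λ z → InCone z (suc y)) 1+source≡target+2l (InCone-suc cone))
    regroup : ∀ a b c d e → a + (b + c) + (d + e) ≡ (a + b) + (d + c + e)
    regroup = solve-∀

  augPaths-split : ∀ n {M} → target ≤ M → Splits n M
  augPaths-split zero    target≤M = splits-zero target≤M
  augPaths-split (suc n) {M} target≤M (x≤source , cone) with m≤n⇒m<n∨m≡n x≤source
  ... | inj₁ x<source = splits-off-source {n} {M} (augPaths-split n target≤M) x<source cone
  ... | inj₂ refl     = splits-at-source {n} {M} (augPaths-split n target≤M) target≤M cone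

  Ztilde-vanishes : ∀ {M N} → N < M → Ztilde l k M N ≡ 0
  Ztilde-vanishes {M} {N} = paths-beyond-reach (augModel l k) augModel-rightmost N 0 0 M

  Ztilde-expansion : ∀ J N {M} → target ≤ M →
    Ztilde l k M N ≡ sumTo J (λ j → Zaux l (M + 2 * j * l) N) + Ztilde l k (M + suc J * (2 * l)) N
  Ztilde-expansion J N {M} target≤M = begin
    augPaths 0 0 N M
      ≡⟨ telescope (auxPaths 0 0 N) (augPaths 0 0 N) (2 * l)
           (λ target≤M′ → augPaths-split N target≤M′ (z≤n , inCone 0)) J target≤M ⟩
    sumTo J (λ j → auxPaths 0 0 N (M + j * (2 * l))) + augPaths 0 0 N (M + suc J * (2 * l))
      ≡⟨ cong (_+ augPaths 0 0 N (M + suc J * (2 * l)))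
           (sumTo-cong J (λ j → cong (λ n → auxPaths 0 0 N (M + n)) (reorder j l))) ⟩
    sumTo J (λ j → auxPaths 0 0 N (M + 2 * j * l)) + augPaths 0 0 N (M + suc J * (2 * l)) ∎
    where
    reorder : ∀ j l → j * (2 * l) ≡ 2 * j * l
    reorder = solve-∀

corollary4p5 : (l k m : ℕ) → 2 ≤ l → 1 ≤ k → k ≤ m →
    (M N : ℕ) → 2 ∣ (M + N) → l * m ∸ 1 ≤ M → M ≤ l * (m + 1) ∸ 2 →
    Ztilde l k M N ≡ floorSum (N + 1) (l * m) (2 * l) (λ j → Zaux l (M + 2 * j * l) N)
-- The identity holds for every M ≥ lk − 1.
corollary4p5 (suc (suc l′)) (suc k′) m (s≤s (s≤s z≤n)) (s≤s z≤n) k≤m M N _ lm∸1≤M _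
  with N + 1 <? suc (suc l′) * m
... | yes N+1<lm =
  trans (Ztilde-vanishes (below-first-term N+1<lm lm∸1≤M)) (sym (floorSum-< (2 * l) _ N+1<lm))
  where open LongSteps l′ k′
... | no  N+1≮lm = begin
  Ztilde l k M N
    ≡⟨ Ztilde-expansion J N (≤-trans (∸-monoˡ-≤ 1 (*-monoʳ-≤ l k≤m)) lm∸1≤M) ⟩
  sumTo J term + Ztilde l k (M + suc J * (2 * l)) N
    ≡⟨ cong (sumTo J term +_) (Ztilde-vanishes (beyond-last-term (2 * l) (s≤s z≤n) lm≤N+1 lm∸1≤M)) ⟩
  sumTo J term + 0
    ≡⟨ +-identityʳ _ ⟩
  sumTo J term
    ≡⟨ floorSum-≥ (2 * l) term lm≤N+1 ⟨
  floorSum (N + 1) (l * m) (2 * l) term ∎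
  where
  open LongSteps l′ k′
  lm≤N+1 : l * m ≤ N + 1
  lm≤N+1 = ≮⇒≥ N+1≮lm
  J : ℕ
  J = floorDiv (N + 1 ∸ l * m) (2 * l)
  term : ℕ → ℕ
  term j = Zaux l (M + 2 * j * l) N
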